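{- Let $m\ge1$, $C=\{1,\dots,2m\}$ and $\pi=(1\,2)(3\,4)\cdots(2m-1\;2m)$. Let $P$ be a combinatorial map on $C$ with edge involution $\rho=P\pi P^{ -1}$, and let $C=C_1\sqcup C_2$ fix the knot $\mu=[\pi;\rho]$. Let $B:i\mapsto s_i$ be the bijection obtained by writing each orbit of $\mu$ as a cyclic sequence starting at an element of $C_1$ and concatenating these sequences, in some order, into a string $s_1\cdots s_{2m}$. Let $T=B^{ -1}$. Then $T^\pi=T$, i.e. $\pi^{ -1}T\pi=T$, so $T$ commutes with $\pi$.
   Context: Permutations act on the right: $a^\sigma$ is the image of $a$ under $\sigma$. Products are read left to right, $a^{\sigma\tau}=(a^\sigma)^\tau$, and conjugation is $x^y=y^{ -1}xy$. A (normalized) combinatorial map on $C$ is any permutation $P$ of $C$ (the vertex rotation), with face rotation $Q=P\pi$ and edge involution $\rho=PQ^{ -1}=P\pi P^{ -1}$. Fixing a combinatorial knot means choosing a partition $C=C_1\sqcup C_2$ such that both $\pi$ and $\rho$ map $C_1$ bijectively onto $C_2$. The knot $\mu=[\pi;\rho]$ is the permutation with $a^\mu=a^\pi$ for $a\in C_1$ and $a^\mu=a^\rho$ for $a\in C_2$. $T=B^{ -1}$ is the renumbering permutation transforming the knot $\mu$ into the normalized form $\mu^T=I$, where $I$ has orbits consisting of consecutive integers in increasing cyclic order. -}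

module Defs where

open import Data.Nat using (ℕ; zero; suc; _*_)
open import Data.Fin using (Fin; zero; suc)
open import Data.Bool using (Bool; true; false; if_then_else_)
open import Data.List using (List; []; _∷_; concat; tabulate)
open import Data.List.Relation.Unary.All using (All)
open import Data.Product using (Σ; _×_; ∃)
open import Data.Empty using (⊥)
open import Relation.Binary.PropositionalEquality using (_≡_; refl; cong)
open import Data.Fin.Permutation
  using (Permutation′; permutation; _⟨$⟩ʳ_; _⟨$⟩ˡ_; _∘ₚ_; flip)

-- Conventions: C = {1,…,2m} is modelled 0-based as Fin (m * 2)
-- (element k+1 of the paper is  k : Fin (m * 2)).
-- Permutations are Data.Fin.Permutation.Permutation′; the paper's
-- right action a^σ is  σ ⟨$⟩ʳ a,  and  σ ∘ₚ τ  is "first σ, then τ",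
-- i.e. the paper's left-to-right product στ.  σ⁻¹ is  flip σ.

pairSwap : ∀ m → Fin (m * 2) → Fin (m * 2)
pairSwap (suc m) zero = suc zero
pairSwap (suc m) (suc zero) = zero
pairSwap (suc m) (suc (suc i)) = suc (suc (pairSwap m i))

pairSwap-invol : ∀ m (i : Fin (m * 2)) → pairSwap m (pairSwap m i) ≡ i
pairSwap-invol (suc m) zero = refl
pairSwap-invol (suc m) (suc zero) = refl
pairSwap-invol (suc m) (suc (suc i)) = cong (λ x → suc (suc x)) (pairSwap-invol m i)

πₘ : ∀ m → Permutation′ (m * 2)
πₘ m = permutation (pairSwap m) (pairSwap m) (pairSwap-invol m) (pairSwap-invol m)

edgeInv : ∀ m → Permutation′ (m * 2) → Permutation′ (m * 2)
edgeInv m P = P ∘ₚ πₘ m ∘ₚ flip P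

-- a subset C₁ of C is given by its characteristic function; C₂ is its complement
-- σ maps C₁ bijectively onto C₂ (σ is already a bijection of C, so injectivity is automatic)
MapsOnto : ∀ {n} → (Fin n → Bool) → Permutation′ n → Set
MapsOnto {n} C₁ σ =
  (∀ a → C₁ a ≡ true → C₁ (σ ⟨$⟩ʳ a) ≡ false) ×
  (∀ b → C₁ b ≡ false → Σ (Fin n) λ a → C₁ a ≡ true × σ ⟨$⟩ʳ a ≡ b)

FixesKnot : ∀ {n} → Permutation′ n → Permutation′ n → (Fin n → Bool) → Set
FixesKnot π ρ C₁ = MapsOnto C₁ π × MapsOnto C₁ ρ

knot : ∀ {n} → Permutation′ n → Permutation′ n → (Fin n → Bool) → Fin n → Fin n
knot π ρ C₁ a = if C₁ a then π ⟨$⟩ʳ a else ρ ⟨$⟩ʳ a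

Walk : ∀ {n} → (Fin n → Fin n) → Fin n → List (Fin n) → Fin n → Set
Walk f x [] s = f x ≡ s
Walk f x (y ∷ ys) s = f x ≡ y × Walk f y ys s

CyclicBlock : ∀ {n} → (Fin n → Fin n) → (Fin n → Bool) → List (Fin n) → Set
CyclicBlock μ C₁ [] = ⊥
CyclicBlock μ C₁ (x ∷ xs) = C₁ x ≡ true × Walk μ x xs x

string : ∀ {n} → Permutation′ n → List (Fin n)
string B = tabulate (B ⟨$⟩ʳ_)

-- B arises by writing each orbit of μ as a cyclic sequence starting in C₁ and
-- concatenating these in some order.  (Since B is a bijection, the blocks are
-- pairwise disjoint and cover C, so each block is exactly one orbit and every
-- orbit occurs exactly once.)
OrbitString : ∀ {n} → (Fin n → Fin n) → (Fin n → Bool) → Permutation′ n → Set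
OrbitString {n} μ C₁ B =
  Σ (List (List (Fin n))) λ blocks →
    All (CyclicBlock μ C₁) blocks × concat blocks ≡ string B

-- The knot μ = [π;ρ] alternates between C₁ and C₂: on C₁ it acts as π and
-- lands in C₂, on C₂ it acts as ρ and lands back in C₁.  Hence an orbit of μ
-- written as a cyclic sequence x, x^μ, x^μ², … starting in C₁ has the shape
--   x₁, x₁^π, x₂, x₂^π, …
-- i.e. it splits into consecutive pairs (y, y^π).  Concatenating such
-- blocks preserves this shape, so the string s₁ s₂ … s_{2m} of B satisfies
-- s_{2k} = s_{2k-1}^π, which says exactly that B commutes with π.  Since
-- commuting with a map passes to the inverse permutation, T = B⁻¹ commutes
-- with π as well, i.e. π⁻¹Tπ = T.
module Submission where

open import Defs
open import Data.Nat using (ℕ; suc; _*_; _≥_)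
open import Data.Fin using (Fin; zero; suc)
open import Data.Bool using (Bool; true; false)
open import Data.Unit using (⊤)
open import Data.List using (List; []; _∷_; _++_; concat; tabulate)
open import Data.List.Relation.Unary.All using (All; []; _∷_)
import Data.List.Relation.Unary.All as All
open import Data.Product using (_×_; _,_; proj₁; proj₂)
open import Data.Empty using (⊥; ⊥-elim)
open import Relation.Binary.PropositionalEquality
open import Data.Fin.Permutation
  using (Permutation′; _⟨$⟩ʳ_; _⟨$⟩ˡ_; _∘ₚ_; flip; inverseˡ; inverseʳ)

Paired : ∀ {A : Set} → (A → A) → List A → Set
Paired g []          = ⊤
Paired g (x ∷ [])    = ⊥
Paired g (x ∷ y ∷ r) = y ≡ g x × Paired g r

paired-++ : ∀ {A : Set} (g : A → A) (xs ys : List A) →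
            Paired g xs → Paired g ys → Paired g (xs ++ ys)
paired-++ g []          ys _        q = q
paired-++ g (x ∷ y ∷ r) ys (e , p)  q = e , paired-++ g r ys p q

paired-concat : ∀ {A : Set} (g : A → A) (bs : List (List A)) →
                All (Paired g) bs → Paired g (concat bs)
paired-concat g []       []       = _
paired-concat g (b ∷ bs) (p ∷ ps) = paired-++ g b (concat bs) p (paired-concat g bs ps)

true≢false : true ≢ false
true≢false ()

perm-injective : ∀ {n} (σ : Permutation′ n) {a b} → σ ⟨$⟩ʳ a ≡ σ ⟨$⟩ʳ b → a ≡ b
perm-injective σ σa≡σb =
  trans (sym (inverseˡ σ)) (trans (cong (σ ⟨$⟩ˡ_) σa≡σb) (inverseˡ σ))

-- A permutation mapping C₁ onto C₂ also maps C₂ into C₁: the preimage in C₁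
-- of σ b would, by injectivity, be b itself, which lies in C₂.
mapsOnto-back : ∀ {n} (C₁ : Fin n → Bool) (σ : Permutation′ n) → MapsOnto C₁ σ →
                ∀ b → C₁ b ≡ false → C₁ (σ ⟨$⟩ʳ b) ≡ true
mapsOnto-back C₁ σ (_ , onto) b b∈C₂ with C₁ (σ ⟨$⟩ʳ b) in σb∈?
... | true  = refl
... | false with onto (σ ⟨$⟩ʳ b) σb∈?
...   | a , a∈C₁ , σa≡σb = ⊥-elim (true≢false (begin
          true         ≡⟨ sym a∈C₁ ⟩
          C₁ a         ≡⟨ cong C₁ (perm-injective σ σa≡σb) ⟩
          C₁ b         ≡⟨ b∈C₂ ⟩
          false        ∎))
  where open ≡-Reasoning

module KnotOrbits {n} (π ρ : Permutation′ n) (C₁ : Fin n → Bool)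
                  (fixes : FixesKnot π ρ C₁) where

  μ : Fin n → Fin n
  μ = knot π ρ C₁

  μ-on-C₁ : ∀ x → C₁ x ≡ true → μ x ≡ π ⟨$⟩ʳ x × C₁ (μ x) ≡ false
  μ-on-C₁ x x∈C₁ rewrite x∈C₁ = refl , proj₁ (proj₁ fixes) x x∈C₁

  μ-on-C₂ : ∀ x → C₁ x ≡ false → C₁ (μ x) ≡ true
  μ-on-C₂ x x∈C₂ rewrite x∈C₂ = mapsOnto-back C₁ ρ (proj₂ fixes) x x∈C₂

  walk-from-C₁ : ∀ x ys s → C₁ x ≡ true → C₁ s ≡ true →
                 Walk μ x ys s → Paired (π ⟨$⟩ʳ_) (x ∷ ys)
  walk-from-C₂ : ∀ y zs s → C₁ y ≡ false → C₁ s ≡ true →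
                 Walk μ y zs s → Paired (π ⟨$⟩ʳ_) zs

  walk-from-C₁ x [] s x∈C₁ s∈C₁ μx≡s =
    ⊥-elim (true≢false (trans (sym s∈C₁)
             (trans (cong C₁ (sym μx≡s)) (proj₂ (μ-on-C₁ x x∈C₁)))))
  walk-from-C₁ x (y ∷ zs) s x∈C₁ s∈C₁ (μx≡y , walk) =
    trans (sym μx≡y) μx≡πx ,
    walk-from-C₂ y zs s (subst (λ z → C₁ z ≡ false) μx≡y μx∈C₂) s∈C₁ walk
    where
    μx≡πx : μ x ≡ π ⟨$⟩ʳ x
    μx≡πx = proj₁ (μ-on-C₁ x x∈C₁)
    μx∈C₂ : C₁ (μ x) ≡ false
    μx∈C₂ = proj₂ (μ-on-C₁ x x∈C₁)

  walk-from-C₂ y []       s _    _    _              = _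
  walk-from-C₂ y (z ∷ zs) s y∈C₂ s∈C₁ (μy≡z , walk) =
    walk-from-C₁ z zs s (subst (λ w → C₁ w ≡ true) μy≡z (μ-on-C₂ y y∈C₂)) s∈C₁ walk

  block-paired : ∀ b → CyclicBlock μ C₁ b → Paired (π ⟨$⟩ʳ_) b
  block-paired (x ∷ xs) (x∈C₁ , walk) = walk-from-C₁ x xs x x∈C₁ x∈C₁ walk

  string-paired : ∀ B → OrbitString μ C₁ B → Paired (π ⟨$⟩ʳ_) (string B)
  string-paired B (blocks , blocks-ok , concat≡string) =
    subst (Paired (π ⟨$⟩ʳ_)) concat≡string
      (paired-concat (π ⟨$⟩ʳ_) blocks (All.map (block-paired _) blocks-ok))

tabulate-paired : ∀ {A : Set} (g : A → A) → (∀ x → g (g x) ≡ x) →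
                  ∀ k (f : Fin (k * 2) → A) → Paired g (tabulate f) →
                  ∀ i → f (pairSwap k i) ≡ g (f i)
tabulate-paired g invol (suc k) f (f₁≡gf₀ , _) zero = f₁≡gf₀
tabulate-paired g invol (suc k) f (f₁≡gf₀ , _) (suc zero) =
  trans (sym (invol (f zero))) (cong g (sym f₁≡gf₀))
tabulate-paired g invol (suc k) f (_ , rest) (suc (suc i)) =
  tabulate-paired g invol k (λ j → f (suc (suc j))) rest i

inverse-commutes : ∀ {n} (B : Permutation′ n) (g : Fin n → Fin n) →
                   (∀ i → B ⟨$⟩ʳ g i ≡ g (B ⟨$⟩ʳ i)) →
                   ∀ a → B ⟨$⟩ˡ g a ≡ g (B ⟨$⟩ˡ a)
inverse-commutes B g commutes a = begin
  B ⟨$⟩ˡ g a                        ≡⟨ cong (λ z → B ⟨$⟩ˡ g z) (sym (inverseʳ B)) ⟩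
  B ⟨$⟩ˡ g (B ⟨$⟩ʳ (B ⟨$⟩ˡ a))     ≡⟨ cong (B ⟨$⟩ˡ_) (sym (commutes (B ⟨$⟩ˡ a))) ⟩
  B ⟨$⟩ˡ (B ⟨$⟩ʳ g (B ⟨$⟩ˡ a))     ≡⟨ inverseˡ B ⟩
  g (B ⟨$⟩ˡ a)                      ∎
  where open ≡-Reasoning

theorem13 : (m : ℕ) → m ≥ 1 →
    (P : Permutation′ (m * 2)) → (C₁ : Fin (m * 2) → Bool) →
    FixesKnot (πₘ m) (edgeInv m P) C₁ →
    (B : Permutation′ (m * 2)) →
    OrbitString (knot (πₘ m) (edgeInv m P) C₁) C₁ B →
    ∀ a → (flip (πₘ m) ∘ₚ flip B ∘ₚ πₘ m) ⟨$⟩ʳ a ≡ flip B ⟨$⟩ʳ a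
theorem13 m _ P C₁ fixes B orbitString a = begin
  pairSwap m (B ⟨$⟩ˡ pairSwap m a)    ≡⟨ cong (pairSwap m) (T-commutes a) ⟩
  pairSwap m (pairSwap m (B ⟨$⟩ˡ a))  ≡⟨ pairSwap-invol m (B ⟨$⟩ˡ a) ⟩
  B ⟨$⟩ˡ a                             ∎
  where
  open ≡-Reasoning
  open KnotOrbits (πₘ m) (edgeInv m P) C₁ fixes using (string-paired)

  B-commutes : ∀ i → B ⟨$⟩ʳ pairSwap m i ≡ pairSwap m (B ⟨$⟩ʳ i)
  B-commutes = tabulate-paired (pairSwap m) (pairSwap-invol m) m (B ⟨$⟩ʳ_)
                 (string-paired B orbitString)

  T-commutes : ∀ a → B ⟨$⟩ˡ pairSwap m a ≡ pairSwap m (B ⟨$⟩ˡ a)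
  T-commutes = inverse-commutes B (pairSwap m) B-commutes
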